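{- (a) If $\Gamma\vdash_{C2_O}t:O(a)$ and $t\succ_Ct'$, then $t=t'$. (b) If $y_1:A_1,\dots,y_n:A_n,x_1:O(a_1),\dots,x_m:O(a_m)\vdash_{C2_O}t:O(a)$ and none of $A_1,\dots,A_n$ ends with $O$, then $t=x_j$ for some $j$ with $a_j\approx a$.
   Context: $\lambda C$-terms are terms of the pure $\lambda$-calculus extended with a constant $C$; $(t)u_1\dots u_n$ is iterated application. $\succ_C$ is the reflexive–transitive closure of $(\lambda xu)t\,t_1\dots t_n\to(u[t/x])t_1\dots t_n$ and $(C)t\,t_1\dots t_n\to(t)\lambda x(x)t_1\dots t_n$ ($x$ fresh). Types: second-order formulas built from $\perp$ and atomic formulas using $\rightarrow,\forall x,\forall X$; $\neg A=A\rightarrow\perp$; equations $u=v:=\forall Y(Y(u)\rightarrow Y(v))$ and a fixed set of equations, $a\approx b$ meaning $a=b$ follows from it. A type ends with $X$ if it is $X(\vec t)$, or $A\rightarrow B$ with $B$ ending with $X$, or $\forall vA$ with $A$ ending with $X$. $O$ is a particular unary predicate symbol and $a,a_j$ are first-order terms. System $C2_O$ has rules: axiom; $\rightarrow$-intro restricted: from $\Gamma,x:A\vdash t:B$ with neither $A$ nor $B$ ending with $O$ infer $\Gamma\vdash\lambda xt:A\rightarrow B$; $\rightarrow$-elim; $\forall x$-intro ($x$ not free in $\Gamma$)/elim (any term); $\forall X$-intro ($X$ not free in $\Gamma$); $\forall X$-elim restricted: from $t:\forall XA$ infer $t:A[G/X]$ only when $G$ does not end with $O$; equational rule (from $t:A[u/x]$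 and $u\approx v$ infer $t:A[v/x]$); and $\Gamma\vdash C:\forall X\{\neg\neg X\rightarrow X\}$. -}

module Defs where

open import Data.Nat using (ℕ; zero; suc; _≟_)
open import Data.Fin using (Fin; toℕ)
open import Data.Vec using (Vec; []; _∷_; tabulate)
open import Data.List using (List; []; _∷_; map)
open import Relation.Nullary using (¬_; yes; no)
open import Relation.Binary.Construct.Closure.ReflexiveTransitive using (Star)

liftℕ : (ℕ → ℕ) → ℕ → ℕ
liftℕ f zero = zero
liftℕ f (suc x) = suc (f x)

data Λ : Set where
  v   : ℕ → Λ
  ƛ   : Λ → Λ
  _·_ : Λ → Λ → Λ
  cc  : Λ

infixl 7 _·_

renΛ : (ℕ → ℕ) → Λ → Λ
renΛ ρ (v i) = v (ρ i)
renΛ ρ (ƛ t) = ƛ (renΛ (liftℕ ρ) t)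
renΛ ρ (t · u) = renΛ ρ t · renΛ ρ u
renΛ ρ cc = cc

extsΛ : (ℕ → Λ) → ℕ → Λ
extsΛ σ zero = v zero
extsΛ σ (suc i) = renΛ suc (σ i)

substΛ : (ℕ → Λ) → Λ → Λ
substΛ σ (v i) = σ i
substΛ σ (ƛ t) = ƛ (substΛ (extsΛ σ) t)
substΛ σ (t · u) = substΛ σ t · substΛ σ u
substΛ σ cc = cc

-- single substitution u[t/x] (x = index 0)
_[_]Λ : Λ → Λ → Λ
u [ t ]Λ = substΛ σ u
  where
  σ : ℕ → Λ
  σ zero = t
  σ (suc i) = v i

_·*_ : Λ → List Λ → Λ
t ·* [] = t
t ·* (u ∷ us) = (t · u) ·* us

data _⟶_ : Λ → Λ → Set where
  β  : ∀ u t ts → ((ƛ u · t) ·* ts) ⟶ ((u [ t ]Λ) ·* ts)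
  cC : ∀ t ts → ((cc · t) ·* ts) ⟶ (t · ƛ (v zero ·* map (renΛ suc) ts))

_≻C_ : Λ → Λ → Set
_≻C_ = Star _⟶_

module Syntax (Fun : ℕ → Set) (Pred : ℕ → Set) (O : Pred 1) where

  data Tm : Set where
    var : ℕ → Tm
    fun : ∀ {n} → Fun n → Vec Tm n → Tm

  mutual
    substT : (ℕ → Tm) → Tm → Tm
    substT σ (var i) = σ i
    substT σ (fun f ts) = fun f (substTs σ ts)

    substTs : ∀ {n} → (ℕ → Tm) → Vec Tm n → Vec Tm n
    substTs σ [] = []
    substTs σ (t ∷ ts) = substT σ t ∷ substTs σ ts

  shiftT : Tm → Tm
  shiftT = substT (λ i → var (suc i))

  -- Second-order variables: pvar n X ts is X(ts) with X of arity n,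
  -- X a de Bruijn index counting only binders ∀₂ n of the same arity n.
  data Form : Set where
    ⊥'   : Form
    pred : ∀ {n} → Pred n → Vec Tm n → Form
    pvar : (n : ℕ) → ℕ → Vec Tm n → Form
    _⇒_  : Form → Form → Form
    ∀₁   : Form → Form
    ∀₂   : (n : ℕ) → Form → Form

  infixr 5 _⇒_

  ¬'_ : Form → Form
  ¬' A = A ⇒ ⊥'

  O⟨_⟩ : Tm → Form
  O⟨ a ⟩ = pred O (a ∷ [])

  exts : (ℕ → Tm) → ℕ → Tm
  exts σ zero = var zero
  exts σ (suc i) = shiftT (σ i)

  substF1 : (ℕ → Tm) → Form → Form
  substF1 σ ⊥' = ⊥'
  substF1 σ (pred P ts) = pred P (substTs σ ts)
  substF1 σ (pvar n X ts) = pvar n X (substTs σ ts)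
  substF1 σ (A ⇒ B) = substF1 σ A ⇒ substF1 σ B
  substF1 σ (∀₁ A) = ∀₁ (substF1 (exts σ) A)
  substF1 σ (∀₂ n A) = ∀₂ n (substF1 σ A)

  shiftF1 : Form → Form
  shiftF1 = substF1 (λ i → var (suc i))

  extsN : ℕ → (ℕ → Tm) → ℕ → Tm
  extsN zero σ = σ
  extsN (suc n) σ = exts (extsN n σ)

  -- A[u/x], x = first-order index 0
  _[_/1] : Form → Tm → Form
  A [ u /1] = substF1 σ A
    where
    σ : ℕ → Tm
    σ zero = u
    σ (suc i) = var i

  lift2 : ℕ → (ℕ → ℕ → ℕ) → ℕ → ℕ → ℕ
  lift2 m r k X with k ≟ m
  ... | yes _ = liftℕ (r k) X
  ... | no _ = r k X

  ren2 : (ℕ → ℕ → ℕ) → Form → Form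
  ren2 r ⊥' = ⊥'
  ren2 r (pred P ts) = pred P ts
  ren2 r (pvar n X ts) = pvar n (r n X) ts
  ren2 r (A ⇒ B) = ren2 r A ⇒ ren2 r B
  ren2 r (∀₁ A) = ∀₁ (ren2 r A)
  ren2 r (∀₂ m A) = ∀₂ m (ren2 (lift2 m r) A)

  shift2 : ℕ → ℕ → ℕ → ℕ
  shift2 m k X with k ≟ m
  ... | yes _ = suc X
  ... | no _ = X

  -- arguments of an n-ary instance: args ts i = i-th entry for i < n,
  -- and var (i - n) otherwise
  args : ∀ {n} → Vec Tm n → ℕ → Tm
  args [] i = var i
  args (t ∷ ts) zero = t
  args (t ∷ ts) (suc i) = args ts i

  idC : (n : ℕ) → ℕ → Form
  idC n X = pvar n X (tabulate (λ i → var (toℕ i)))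

  -- Simultaneous second-order substitution: ρ n X is a formula G whose
  -- first-order variables 0..n-1 are the n arguments of X (the others
  -- being free variables, shifted by n).
  ext2 : ℕ → (ℕ → ℕ → Form) → ℕ → ℕ → Form
  ext2 m ρ k X with k ≟ m
  ext2 m ρ k zero | yes _ = idC k zero
  ext2 m ρ k (suc X) | yes _ = ren2 (shift2 m) (ρ k X)
  ext2 m ρ k X | no _ = ren2 (shift2 m) (ρ k X)

  substF2 : (ℕ → ℕ → Form) → Form → Form
  substF2 ρ ⊥' = ⊥'
  substF2 ρ (pred P ts) = pred P ts
  substF2 ρ (pvar n X ts) = substF1 (args ts) (ρ n X)
  substF2 ρ (A ⇒ B) = substF2 ρ A ⇒ substF2 ρ B
  substF2 ρ (∀₁ A) =
    ∀₁ (substF2 (λ n X → substF1 (extsN n (λ i → var (suc i))) (ρ n X)) A)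
  substF2 ρ (∀₂ m A) = ∀₂ m (substF2 (ext2 m ρ) A)

  -- A[G/X], X = the n-ary second-order variable of index 0
  _[_/2_] : Form → Form → ℕ → Form
  A [ G /2 n ] = substF2 σ A
    where
    σ : ℕ → ℕ → Form
    σ k X with k ≟ n
    σ k zero | yes _ = G
    σ k (suc X) | yes _ = idC k X
    σ k X | no _ = idC k X

  data EndsO : Form → Set where
    atom : ∀ a → EndsO O⟨ a ⟩
    imp  : ∀ {A B} → EndsO B → EndsO (A ⇒ B)
    all1 : ∀ {A} → EndsO A → EndsO (∀₁ A)
    all2 : ∀ {n A} → EndsO A → EndsO (∀₂ n A)

  -- context membership (index 0 = last declared variable)
  data _∋_∶_ : List Form → ℕ → Form → Set where
    here  : ∀ {Γ A} → (A ∷ Γ) ∋ zero ∶ A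
    there : ∀ {Γ A B i} → Γ ∋ i ∶ A → (B ∷ Γ) ∋ suc i ∶ A

  module Typing (E : Tm → Tm → Set) where

    data _≈_ : Tm → Tm → Set
    data _≈s_ : ∀ {n} → Vec Tm n → Vec Tm n → Set

    data _≈_ where
      ax    : ∀ {u w} → E u w → (σ : ℕ → Tm) → substT σ u ≈ substT σ w
      refl≈ : ∀ {u} → u ≈ u
      sym≈  : ∀ {u w} → u ≈ w → w ≈ u
      trans≈ : ∀ {u w z} → u ≈ w → w ≈ z → u ≈ z
      cong≈ : ∀ {n} (f : Fun n) {us ws} → us ≈s ws → fun f us ≈ fun f ws

    data _≈s_ where
      []  : [] ≈s []
      _∷_ : ∀ {n u w} {us ws : Vec Tm n} → u ≈ w → us ≈s ws → (u ∷ us) ≈s (w ∷ ws)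

    data _⊢_∶_ : List Form → Λ → Form → Set where
      axiom : ∀ {Γ i A} → Γ ∋ i ∶ A → Γ ⊢ v i ∶ A
      →I    : ∀ {Γ t A B} → (A ∷ Γ) ⊢ t ∶ B → ¬ EndsO A → ¬ EndsO B →
              Γ ⊢ ƛ t ∶ (A ⇒ B)
      →E    : ∀ {Γ t u A B} → Γ ⊢ t ∶ (A ⇒ B) → Γ ⊢ u ∶ A → Γ ⊢ t · u ∶ B
      ∀₁I   : ∀ {Γ t A} → map shiftF1 Γ ⊢ t ∶ A → Γ ⊢ t ∶ ∀₁ A
      ∀₁E   : ∀ {Γ t A} → Γ ⊢ t ∶ ∀₁ A → (u : Tm) → Γ ⊢ t ∶ (A [ u /1])
      ∀₂I   : ∀ {Γ t n A} → map (ren2 (shift2 n)) Γ ⊢ t ∶ A → Γ ⊢ t ∶ ∀₂ n A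
      ∀₂E   : ∀ {Γ t n A} → Γ ⊢ t ∶ ∀₂ n A → (G : Form) → ¬ EndsO G →
              Γ ⊢ t ∶ (A [ G /2 n ])
      eqR   : ∀ {Γ t u w} (A : Form) → Γ ⊢ t ∶ (A [ u /1]) → u ≈ w →
              Γ ⊢ t ∶ (A [ w /1])
      axC   : ∀ {Γ} → Γ ⊢ cc ∶ ∀₂ 0 (¬' ¬' pvar 0 zero [] ⇒ pvar 0 zero [])

module Submission where

-- (a) A derivation whose conclusion ends with O must finish with a chain of
--     eliminations starting from an axiom: the restricted →-introduction
--     cannot produce such a type, and the quantifier and equational rules
--     neither create nor destroy the property "ends with O" (the restricted
--     ∀X-elimination only substitutes formulas not ending with O).  Hence the
--     subject is variable-headed, (x) u₁ … uₙ, and such a term is a weak head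
--     normal form for ≻C.
-- (b) If moreover every hypothesis either does not end with O or is an atom
--     O(b), the same induction shows that the subject is a single variable
--     x : O(b), and that the conclusion is O(b) up to equations, possibly
--     under quantifiers which do not bind anything in b; an application would
--     require a hypothesis of the form … → O(c).

open import Defs
open import Data.Nat using (ℕ; zero; suc; _≟_)
open import Data.Fin using (Fin; toℕ)
open import Data.List using (List; map; _++_; lookup; []; _∷_)
open import Data.List.Relation.Unary.All using (All; []; _∷_; universal)
import Data.List.Relation.Unary.All as All
open import Data.List.Relation.Unary.All.Properties using (++⁺; map⁺)
open import Data.Product using (_×_; ∃-syntax; _,_)
open import Data.Sum using (_⊎_; inj₁; inj₂)
open import Data.Empty using (⊥-elim)
open import Data.Vec using (Vec; replicate)
import Data.Vec as V
open import Relation.Nullary using (¬_; yes; no)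
open import Relation.Binary.PropositionalEquality
  using (_≡_; refl; sym; trans; cong; cong₂; subst; subst₂)
open import Relation.Binary.Construct.Closure.ReflexiveTransitive using (ε; _◅_)

data VarHeaded : Λ → Set where
  var : ∀ i → VarHeaded (v i)
  app : ∀ {t u} → VarHeaded t → VarHeaded (t · u)

varHeaded-·*⁻ : ∀ t us → VarHeaded (t ·* us) → VarHeaded t
varHeaded-·*⁻ t [] h = h
varHeaded-·*⁻ t (u ∷ us) h with varHeaded-·*⁻ (t · u) us h
... | app h' = h'

-- Both reduction rules need a λ or C in head position.
varHeaded-irreducible : ∀ {t t'} → VarHeaded t → ¬ (t ⟶ t')
varHeaded-irreducible h (β u t ts) with varHeaded-·*⁻ (ƛ u · t) ts h
... | app ()
varHeaded-irreducible h (cC t ts) with varHeaded-·*⁻ (cc · t) ts h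
... | app ()

varHeaded-normal : ∀ {t t'} → VarHeaded t → t ≻C t' → t ≡ t'
varHeaded-normal h ε = refl
varHeaded-normal h (s ◅ _) = ⊥-elim (varHeaded-irreducible h s)

module Formulas (Fun : ℕ → Set) (Pred : ℕ → Set) (O : Pred 1) where
  open Syntax Fun Pred O

  mutual
    substT-∘ : ∀ ρ σ t → substT ρ (substT σ t) ≡ substT (λ i → substT ρ (σ i)) t
    substT-∘ ρ σ (var i) = refl
    substT-∘ ρ σ (fun f ts) = cong (fun f) (substTs-∘ ρ σ ts)

    substTs-∘ : ∀ {n} ρ σ (ts : Vec Tm n) →
                substTs ρ (substTs σ ts) ≡ substTs (λ i → substT ρ (σ i)) ts
    substTs-∘ ρ σ V.[] = refl
    substTs-∘ ρ σ (t V.∷ ts) = cong₂ V._∷_ (substT-∘ ρ σ t) (substTs-∘ ρ σ ts)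

  mutual
    substT-id : ∀ t → substT var t ≡ t
    substT-id (var i) = refl
    substT-id (fun f ts) = cong (fun f) (substTs-id ts)

    substTs-id : ∀ {n} (ts : Vec Tm n) → substTs var ts ≡ ts
    substTs-id V.[] = refl
    substTs-id (t V.∷ ts) = cong₂ V._∷_ (substT-id t) (substTs-id ts)

  exts-shiftT : ∀ σ b → substT (exts σ) (shiftT b) ≡ shiftT (substT σ b)
  exts-shiftT σ b = trans (substT-∘ (exts σ) (λ i → var (suc i)) b)
                          (sym (substT-∘ (λ i → var (suc i)) σ b))

  -- The substitution performed by A [ u /1].  It is extracted from an
  -- instance of an atom, so that substF1 (inst1 u) A and A [ u /1] are
  -- definitionally equal.
  inst1 : Tm → ℕ → Tm
  inst1 u i = argument (O⟨ var i ⟩ [ u /1])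
    where
    argument : Form → Tm
    argument (pred P (c V.∷ V.[])) = c
    argument _ = var zero

  inst1-shiftT : ∀ u b → substT (inst1 u) (shiftT b) ≡ b
  inst1-shiftT u b = trans (substT-∘ (inst1 u) (λ i → var (suc i)) b) (substT-id b)

  endsO-substF1 : ∀ σ {A} → EndsO A → EndsO (substF1 σ A)
  endsO-substF1 σ (atom a) = atom (substT σ a)
  endsO-substF1 σ (imp e) = imp (endsO-substF1 σ e)
  endsO-substF1 σ (all1 e) = all1 (endsO-substF1 (exts σ) e)
  endsO-substF1 σ (all2 e) = all2 (endsO-substF1 σ e)

  endsO-substF1⁻ : ∀ σ A → EndsO (substF1 σ A) → EndsO A
  endsO-substF1⁻ σ ⊥' ()
  endsO-substF1⁻ σ (pred P V.[]) ()
  endsO-substF1⁻ σ (pred P (c V.∷ V.[])) (atom _) = atom c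
  endsO-substF1⁻ σ (pred P (c V.∷ d V.∷ ds)) ()
  endsO-substF1⁻ σ (pvar n X ts) ()
  endsO-substF1⁻ σ (A ⇒ B) (imp e) = imp (endsO-substF1⁻ σ B e)
  endsO-substF1⁻ σ (∀₁ A) (all1 e) = all1 (endsO-substF1⁻ (exts σ) A e)
  endsO-substF1⁻ σ (∀₂ n A) (all2 e) = all2 (endsO-substF1⁻ σ A e)

  endsO-ren2⁻ : ∀ r A → EndsO (ren2 r A) → EndsO A
  endsO-ren2⁻ r ⊥' ()
  endsO-ren2⁻ r (pred P ts) e = e
  endsO-ren2⁻ r (pvar n X ts) ()
  endsO-ren2⁻ r (A ⇒ B) (imp e) = imp (endsO-ren2⁻ r B e)
  endsO-ren2⁻ r (∀₁ A) (all1 e) = all1 (endsO-ren2⁻ r A e)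
  endsO-ren2⁻ r (∀₂ n A) (all2 e) = all2 (endsO-ren2⁻ (lift2 n r) A e)

  NonO : (ℕ → ℕ → Form) → Set
  NonO ρ = ∀ k X → ¬ EndsO (ρ k X)

  nonO-ext2 : ∀ m ρ → NonO ρ → NonO (ext2 m ρ)
  nonO-ext2 m ρ h k X with k ≟ m
  nonO-ext2 m ρ h k zero | yes _ = λ ()
  nonO-ext2 m ρ h k (suc X) | yes _ = λ e → h k X (endsO-ren2⁻ (shift2 m) (ρ k X) e)
  nonO-ext2 m ρ h k X | no _ = λ e → h k X (endsO-ren2⁻ (shift2 m) (ρ k X) e)

  endsO-substF2⁻ : ∀ ρ → NonO ρ → ∀ A → EndsO (substF2 ρ A) → EndsO A
  endsO-substF2⁻ ρ h ⊥' ()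
  endsO-substF2⁻ ρ h (pred P ts) e = e
  endsO-substF2⁻ ρ h (pvar n X ts) e = ⊥-elim (h n X (endsO-substF1⁻ (args ts) (ρ n X) e))
  endsO-substF2⁻ ρ h (A ⇒ B) (imp e) = imp (endsO-substF2⁻ ρ h B e)
  endsO-substF2⁻ ρ h (∀₁ A) (all1 e) =
    all1 (endsO-substF2⁻ _ (λ k X e' → h k X (endsO-substF1⁻ _ (ρ k X) e')) A e)
  endsO-substF2⁻ ρ h (∀₂ m A) (all2 e) = all2 (endsO-substF2⁻ (ext2 m ρ) (nonO-ext2 m ρ h) A e)

  inst2-var-nonO : ∀ G n → ¬ EndsO G → ∀ k X (ts : Vec Tm k) →
                   ¬ EndsO (pvar k X ts [ G /2 n ])
  inst2-var-nonO G n h k X ts with k ≟ n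
  inst2-var-nonO G n h k zero ts | yes _ = λ e → h (endsO-substF1⁻ (args ts) G e)
  inst2-var-nonO G n h k (suc X) ts | yes _ = λ ()
  inst2-var-nonO G n h k X ts | no _ = λ ()

  endsO-inst2⁻ : ∀ A G n → ¬ EndsO G → EndsO (A [ G /2 n ]) → EndsO A
  endsO-inst2⁻ A G n h = endsO-substF2⁻ _ (λ k X e → inst2-var-nonO G n h k X (someArgs k)
                                                       (endsO-substF1 (args (someArgs k)) e)) A
    where
    someArgs : ∀ k → Vec Tm k
    someArgs k = replicate k (var zero)

  -- The hypotheses allowed in part (b).
  Admissible : Form → Set
  Admissible A = ¬ EndsO A ⊎ ∃[ b ] (A ≡ O⟨ b ⟩)

  ∋-lookup : ∀ {P : Form → Set} {Γ i A} → All P Γ → Γ ∋ i ∶ A → P A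
  ∋-lookup (p ∷ ps) here = p
  ∋-lookup (p ∷ ps) (there m) = ∋-lookup ps m

  ∋-map⁻ : ∀ {f : Form → Form} {Γ i B} → map f Γ ∋ i ∶ B →
           ∃[ A ] (Γ ∋ i ∶ A × B ≡ f A)
  ∋-map⁻ {Γ = A ∷ Γ} here = A , here , refl
  ∋-map⁻ {Γ = A ∷ Γ} (there m) with ∋-map⁻ m
  ... | A' , m' , eq = A' , there m' , eq

  -- The contexts of ∀₁I and ∀₂I are images of Γ under a map f on formulas
  -- which reflects "ends with O" and sends O(b) to O(g b).
  module ContextMap (f : Form → Form) (g : Tm → Tm)
                    (reflects : ∀ A → EndsO (f A) → EndsO A)
                    (on-atoms : ∀ b → f O⟨ b ⟩ ≡ O⟨ g b ⟩) where

    admissible-map : ∀ {Γ} → All Admissible Γ → All Admissible (map f Γ)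
    admissible-map ps = map⁺ (All.map admissible ps)
      where
      admissible : ∀ {A} → Admissible A → Admissible (f A)
      admissible {A} (inj₁ n) = inj₁ (λ e → n (reflects A e))
      admissible (inj₂ (b , refl)) = inj₂ (g b , on-atoms b)

    O-hyp-map⁻ : ∀ {Γ i c} → All Admissible Γ → map f Γ ∋ i ∶ O⟨ c ⟩ →
                 ∃[ b ] (Γ ∋ i ∶ O⟨ b ⟩ × c ≡ g b)
    O-hyp-map⁻ ps m with ∋-map⁻ m
    ... | A , m' , eq with ∋-lookup ps m'
    ... | inj₁ n = ⊥-elim (n (reflects A (subst EndsO eq (atom _))))
    ... | inj₂ (b , refl) = b , m' , atom-injective (trans eq (on-atoms b))
      where
      atom-injective : ∀ {c d} → O⟨ c ⟩ ≡ O⟨ d ⟩ → c ≡ d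
      atom-injective refl = refl

  module Equations (E : Tm → Tm → Set) where
    open Typing E

    mutual
      substT-≈ : ∀ ρ {u w} → u ≈ w → substT ρ u ≈ substT ρ w
      substT-≈ ρ (ax {u} {w} e σ) =
        subst₂ _≈_ (sym (substT-∘ ρ σ u)) (sym (substT-∘ ρ σ w)) (ax e (λ i → substT ρ (σ i)))
      substT-≈ ρ refl≈ = refl≈
      substT-≈ ρ (sym≈ p) = sym≈ (substT-≈ ρ p)
      substT-≈ ρ (trans≈ p q) = trans≈ (substT-≈ ρ p) (substT-≈ ρ q)
      substT-≈ ρ (cong≈ f ps) = cong≈ f (substTs-≈ ρ ps)

      substTs-≈ : ∀ ρ {n} {us ws : Vec Tm n} → us ≈s ws → substTs ρ us ≈s substTs ρ ws
      substTs-≈ ρ [] = []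
      substTs-≈ ρ (p ∷ ps) = substT-≈ ρ p ∷ substTs-≈ ρ ps

    mutual
      substT-cong : ∀ {σ τ} → (∀ i → σ i ≈ τ i) → ∀ d → substT σ d ≈ substT τ d
      substT-cong h (var i) = h i
      substT-cong h (fun f ts) = cong≈ f (substTs-cong h ts)

      substTs-cong : ∀ {σ τ} → (∀ i → σ i ≈ τ i) → ∀ {n} (ts : Vec Tm n) →
                     substTs σ ts ≈s substTs τ ts
      substTs-cong h V.[] = []
      substTs-cong h (t V.∷ ts) = substT-cong h t ∷ substTs-cong h ts

    exts-cong : ∀ {σ τ} → (∀ i → σ i ≈ τ i) → ∀ i → exts σ i ≈ exts τ i
    exts-cong h zero = refl≈
    exts-cong h (suc i) = substT-≈ _ (h i)

    inst1-cong : ∀ {u w} → u ≈ w → ∀ i → inst1 u i ≈ inst1 w i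
    inst1-cong p zero = p
    inst1-cong p (suc i) = refl≈

    -- IsO b B: B is ∀ξ O(c) for a prefix ξ of quantifiers and c ≈ b, where
    -- b (weakened past the first-order binders of ξ) does not mention ξ.
    data IsO : Tm → Form → Set where
      atom : ∀ {b c} → c ≈ b → IsO b O⟨ c ⟩
      all1 : ∀ {b A} → IsO (shiftT b) A → IsO b (∀₁ A)
      all2 : ∀ {b n A} → IsO b A → IsO b (∀₂ n A)

    isO-substF1 : ∀ σ {b A} → IsO b A → IsO (substT σ b) (substF1 σ A)
    isO-substF1 σ (atom p) = atom (substT-≈ σ p)
    isO-substF1 σ {A = ∀₁ A} (all1 {b} i) =
      all1 (subst (λ c → IsO c (substF1 (exts σ) A)) (exts-shiftT σ b) (isO-substF1 (exts σ) i))
    isO-substF1 σ (all2 i) = all2 (isO-substF1 σ i)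

    isO-inst1 : ∀ A u {b} → IsO (shiftT b) A → IsO b (A [ u /1])
    isO-inst1 A u {b} i =
      subst (λ c → IsO c (substF1 (inst1 u) A)) (inst1-shiftT u b) (isO-substF1 (inst1 u) i)

    isO-substF2 : ∀ ρ {b A} → IsO b A → IsO b (substF2 ρ A)
    isO-substF2 ρ (atom p) = atom p
    isO-substF2 ρ (all1 i) = all1 (isO-substF2 _ i)
    isO-substF2 ρ (all2 i) = all2 (isO-substF2 _ i)

    isO-cong : ∀ {σ τ} → (∀ i → σ i ≈ τ i) → ∀ A {b} →
               IsO b (substF1 σ A) → IsO b (substF1 τ A)
    isO-cong h ⊥' ()
    isO-cong h (pred P V.[]) ()
    isO-cong h (pred P (d V.∷ V.[])) (atom p) = atom (trans≈ (sym≈ (substT-cong h d)) p)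
    isO-cong h (pred P (d V.∷ e V.∷ es)) ()
    isO-cong h (pvar n X ts) ()
    isO-cong h (A ⇒ B) ()
    isO-cong h (∀₁ A) (all1 i) = all1 (isO-cong (exts-cong h) A i)
    isO-cong h (∀₂ n A) (all2 i) = all2 (isO-cong h A i)

    endsO-eqR⁻ : ∀ A {u} w → EndsO (A [ w /1]) → EndsO (A [ u /1])
    endsO-eqR⁻ A {u} w e = endsO-substF1 (inst1 u) (endsO-substF1⁻ _ A e)

    head-variable : ∀ {Γ t B} → Γ ⊢ t ∶ B → EndsO B → VarHeaded t
    head-variable (axiom {i = i} m) e = var i
    head-variable (→I d nA nB) (imp e) = ⊥-elim (nB e)
    head-variable (→E d d') e = app (head-variable d (imp e))
    head-variable (∀₁I d) (all1 e) = head-variable d e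
    head-variable (∀₁E {A = A} d u) e = head-variable d (all1 (endsO-substF1⁻ _ A e))
    head-variable (∀₂I d) (all2 e) = head-variable d e
    head-variable (∀₂E {A = A} d G nG) e = head-variable d (all2 (endsO-inst2⁻ A G _ nG e))
    head-variable (eqR {w = w} A d p) e = head-variable d (endsO-eqR⁻ A w e)
    head-variable axC (all2 (imp ()))

    private
      module Shift1 = ContextMap shiftF1 shiftT (λ A → endsO-substF1⁻ _ A) (λ b → refl)
      module Shift2 (n : ℕ) =
        ContextMap (ren2 (shift2 n)) (λ b → b) (endsO-ren2⁻ (shift2 n)) (λ b → refl)

    O-variable : ∀ {Γ t B} → All Admissible Γ → Γ ⊢ t ∶ B → EndsO B →
                 ∃[ i ] ∃[ b ] (t ≡ v i × Γ ∋ i ∶ O⟨ b ⟩ × IsO b B)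
    O-variable ps (axiom {i = i} m) e with ∋-lookup ps m
    ... | inj₁ n = ⊥-elim (n e)
    ... | inj₂ (b , refl) = i , b , refl , m , atom refl≈
    O-variable ps (→I d nA nB) (imp e) = ⊥-elim (nB e)
    O-variable ps (→E d d') e with O-variable ps d (imp e)
    ... | _ , _ , _ , _ , ()
    O-variable ps (∀₁I d) (all1 e)
      with O-variable (Shift1.admissible-map ps) d e
    ... | i , _ , eq , m' , isO with Shift1.O-hyp-map⁻ ps m'
    ... | b , m , refl = i , b , eq , m , all1 isO
    O-variable ps (∀₁E {A = A} d u) e with O-variable ps d (all1 (endsO-substF1⁻ _ A e))
    ... | i , b , eq , m , all1 isO = i , b , eq , m , isO-inst1 A u isO
    O-variable ps (∀₂I {n = n} d) (all2 e)
      with O-variable (Shift2.admissible-map n ps) d e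
    ... | i , _ , eq , m' , isO with Shift2.O-hyp-map⁻ n ps m'
    ... | b , m , refl = i , b , eq , m , all2 isO
    O-variable ps (∀₂E {A = A} d G nG) e with O-variable ps d (all2 (endsO-inst2⁻ A G _ nG e))
    ... | i , b , eq , m , all2 isO = i , b , eq , m , isO-substF2 _ isO
    O-variable ps (eqR {w = w} A d p) e with O-variable ps d (endsO-eqR⁻ A w e)
    ... | i , b , eq , m , isO = i , b , eq , m , isO-cong (inst1-cong p) A isO
    O-variable ps axC (all2 (imp ()))

    admissible-context : ∀ as ys → All (λ A → ¬ EndsO A) ys →
                         All Admissible (map O⟨_⟩ as ++ ys)
    admissible-context as ys ns =
      ++⁺ (map⁺ (universal (λ b → inj₂ (b , refl)) as)) (All.map inj₁ ns)

    O-hyp-context : ∀ as ys {i b} → All (λ A → ¬ EndsO A) ys →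
                    (map O⟨_⟩ as ++ ys) ∋ i ∶ O⟨ b ⟩ →
                    ∃[ j ] (i ≡ toℕ j × lookup as j ≡ b)
    O-hyp-context [] ys ns m = ⊥-elim (∋-lookup ns m (atom _))
    O-hyp-context (c ∷ cs) ys ns here = Fin.zero , refl , refl
    O-hyp-context (c ∷ cs) ys ns (there m) with O-hyp-context cs ys ns m
    ... | j , refl , q = Fin.suc j , refl , q

    O-typed-normal : ∀ Γ t t' a → Γ ⊢ t ∶ O⟨ a ⟩ → t ≻C t' → t ≡ t'
    O-typed-normal Γ t t' a d = varHeaded-normal (head-variable d (atom a))

    O-typed-hypothesis : ∀ ys as t a → All (λ A → ¬ EndsO A) ys →
                         (map O⟨_⟩ as ++ ys) ⊢ t ∶ O⟨ a ⟩ →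
                         ∃[ j ] (t ≡ v (toℕ j) × lookup as j ≈ a)
    O-typed-hypothesis ys as t a ns d
      with O-variable (admissible-context as ys ns) d (atom a)
    ... | i , b , refl , m , atom p with O-hyp-context as ys ns m
    ... | j , refl , refl = j , refl , sym≈ p

lemma5p2 : (Fun : ℕ → Set) (Pred : ℕ → Set) (O : Pred 1)
    (E : Syntax.Tm Fun Pred O → Syntax.Tm Fun Pred O → Set) →
    let open Syntax Fun Pred O in
    let open Typing E in
    (∀ (Γ : List Form) (t t' : Λ) (a : Tm) →
    Γ ⊢ t ∶ O⟨ a ⟩ → t ≻C t' → t ≡ t')
    ×
    (∀ (ys : List Form) (as : List Tm) (t : Λ) (a : Tm) →
    All (λ A → ¬ EndsO A) ys →
    (map O⟨_⟩ as ++ ys) ⊢ t ∶ O⟨ a ⟩ →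
    ∃[ j ] (t ≡ v (toℕ j) × lookup as j ≈ a))
lemma5p2 Fun Pred O E = O-typed-normal , O-typed-hypothesis
  where open Formulas.Equations Fun Pred O E
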